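{- Let $n\ge 2$, $N=n^2+n+1$, $k$ a positive integer, and let $r_1\ge r_2\ge\dots\ge r_N\ge 1$ be integers. If $$\sum_{i=n+2}^{N} r_i-(k-1)\sum_{i=1}^{n+1} r_i>2k(n+1),$$ then $\mu_{\mathrm{int}}\big(Erd(r_1,\dots,r_N)\big)>k$.
   Context: Graphs are finite and simple. A $k$-improper edge coloring of a graph $G$ is a map $\alpha:E(G)\to\mathbb{N}$ such that at most $k$ edges with a common endpoint receive the same color; it is an improper interval coloring if at every vertex the colors on incident edges form a set of consecutive integers. $\mu_{\mathrm{int}}(G)$ is the smallest $k$ such that $G$ has a $k$-improper interval edge coloring. Let $\pi(n)$ be a finite projective plane of order $n\ge2$ with point set $\{1,\dots,N\}$, $N=n^2+n+1$, and line set $\{l_1,\dots,l_N\}$; let $A_i\subseteq\{1,\dots,N\}$ be the set of points on $l_i$ (so $|A_i|=n+1$). The graph $Erd(r_1,\dots,r_N)$ has vertex set $\{u\}\cup\{1,\dots,N\}\cup\{v^{(l_i)}_1,\dots,v^{(l_i)}_{r_i}:1\le i\le N\}$ and edge set consisting, for each $1\le i\le N$, of the edges $uv^{(l_i)}_j$ ($1\le j\le r_i$) and the edges $v^{(l_i)}_j p$ for $1\le j\le r_i$ and $p\in A_i$. -}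

module Defs where

open import Data.Nat using (ℕ; zero; suc; _+_; _*_; _≤_; _<ᵇ_)
open import Data.Fin using (Fin; zero; suc; toℕ)
open import Data.Fin.Subset using (Subset; _∈_; ∣_∣)
open import Data.Product using (Σ; _×_; _,_)
open import Data.Bool using (if_then_else_)
open import Relation.Binary.PropositionalEquality using (_≡_; _≢_)
open import Relation.Nullary using (¬_)
open import Function.Definitions using (Injective)

record Graph : Set₁ where
  field
    V      : Set
    Adj    : V → V → Set
    sym    : ∀ {x y} → Adj x y → Adj y x
    irrefl : ∀ {x} → ¬ Adj x x

open Graph public

-- An edge colouring: colour α x y of the edge xy (irrelevant on non-edges),
-- well defined on edges (independent of orientation).
record EdgeColoring (G : Graph) : Set where
  field
    col     : V G → V G → ℕ
    col-sym : ∀ x y → Adj G x y → col x y ≡ col y x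

open EdgeColoring public

-- k-improper: at most k edges at a common endpoint get the same colour,
-- i.e. there are no k+1 distinct neighbours y of x with the same colour c on xy.
IsImproper : (G : Graph) → ℕ → EdgeColoring G → Set
IsImproper G k α =
  ∀ (x : V G) (c : ℕ) (f : Fin (suc k) → V G) →
    Injective _≡_ _≡_ f →
    (∀ i → Adj G x (f i)) →
    ¬ (∀ i → col α x (f i) ≡ c)

IsInterval : (G : Graph) → EdgeColoring G → Set
IsInterval G α =
  ∀ (x y z : V G) (c : ℕ) →
    Adj G x y → Adj G x z →
    col α x y ≤ c → c ≤ col α x z →
    Σ (V G) (λ w → Adj G x w × col α x w ≡ c)

HasImproperIntervalColoring : Graph → ℕ → Set
HasImproperIntervalColoring G k =
  Σ (EdgeColoring G) (λ α → IsImproper G k α × IsInterval G α)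

μint-exceeds : Graph → ℕ → Set
μint-exceeds G k = ∀ k' → k' ≤ k → ¬ HasImproperIntervalColoring G k'

Npts : ℕ → ℕ
Npts n = n * n + n + 1

record ProjectivePlane (n : ℕ) : Set where
  field
    A          : Fin (Npts n) → Subset (Npts n)
    line-size  : ∀ i → ∣ A i ∣ ≡ suc n
    two-points : ∀ p q → p ≢ q →
      Σ (Fin (Npts n)) (λ i → (p ∈ A i × q ∈ A i) ×
        (∀ j → p ∈ A j → q ∈ A j → j ≡ i))
    two-lines  : ∀ i j → i ≢ j →
      Σ (Fin (Npts n)) (λ p → (p ∈ A i × p ∈ A j) ×
        (∀ q → q ∈ A i → q ∈ A j → q ≡ p))

open ProjectivePlane public

module _ {n : ℕ} (π : ProjectivePlane n) (r : Fin (Npts n) → ℕ) where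

  data ErdV : Set where
    u   : ErdV
    pt  : Fin (Npts n) → ErdV
    vtx : (i : Fin (Npts n)) → Fin (r i) → ErdV

  data ErdAdj : ErdV → ErdV → Set where
    u-v  : ∀ i j → ErdAdj u (vtx i j)
    v-u  : ∀ i j → ErdAdj (vtx i j) u
    v-p  : ∀ i j p → p ∈ A π i → ErdAdj (vtx i j) (pt p)
    p-v  : ∀ i j p → p ∈ A π i → ErdAdj (pt p) (vtx i j)

  private
    erd-sym : ∀ {x y} → ErdAdj x y → ErdAdj y x
    erd-sym (u-v i j) = v-u i j
    erd-sym (v-u i j) = u-v i j
    erd-sym (v-p i j p m) = p-v i j p m
    erd-sym (p-v i j p m) = v-p i j p m

    erd-irrefl : ∀ {x} → ¬ ErdAdj x x
    erd-irrefl ()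

  Erd : Graph
  Erd = record { V = ErdV ; Adj = ErdAdj ; sym = erd-sym ; irrefl = erd-irrefl }

ΣFin : ∀ {m} → (Fin m → ℕ) → ℕ
ΣFin {zero}  f = 0
ΣFin {suc m} f = f zero + ΣFin (λ i → f (suc i))

-- Σ_{i=1}^{n+1} r_i  (lines with 0-based index < n+1)
headSum : (n : ℕ) → (Fin (Npts n) → ℕ) → ℕ
headSum n r = ΣFin (λ i → if toℕ i <ᵇ suc n then r i else 0)

tailSum : (n : ℕ) → (Fin (Npts n) → ℕ) → ℕ
tailSum n r = ΣFin (λ i → if toℕ i <ᵇ suc n then 0 else r i)

module Submission where

-- Let α be a k-improper interval colouring. The ΣFin r edges at u carry each colour at most
-- k times, so their colours spread over at least ΣFin r / k consecutive values. But any two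
-- v-vertices v, v′ are joined through a common point p of their lines, and in an interval
-- colouring the colours at a vertex span less than its degree: n + 2 at v and v′, and at p at
-- most the sum of the n + 1 largest r_i, since p lies on only n + 1 lines. Hence
-- ΣFin r ≤ k (2 (n + 1) + headSum n r), which the hypothesis rules out.

open import Defs hiding (sym)
open import Data.Nat using (ℕ; zero; suc; _+_; _*_; _∸_; _≤_; _<_; z≤n; s≤s; _<ᵇ_; _≡ᵇ_; _≤?_)
open import Data.Nat.Properties
open import Data.Fin using (Fin; zero; suc; toℕ; splitAt; _↑ˡ_; _↑ʳ_; inject≤; fromℕ<) renaming (_≤_ to _≤ᶠ_)
open import Data.Fin.Properties using (splitAt-↑ˡ; splitAt-↑ʳ; splitAt⁻¹-↑ˡ; splitAt⁻¹-↑ʳ; inject≤-injective; injective⇒≤; toℕ≤pred[n]; ¬∀⟶∃¬; toℕ-injective) renaming (_≟_ to _≟ᶠ_)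
open import Data.Fin.Subset using (Subset; _∈_; _∉_; ∣_∣; Nonempty; ⊤)
open import Data.Fin.Subset.Properties using (_∈?_; nonempty?; Empty-unique; ∣⊥∣≡0; ⊆-antisym; ⊆⊤; ∣⊤∣≡n)
open import Data.Vec using ([]; _∷_; lookup)
open import Data.Vec.Properties using ([]=⇒lookup; lookup⇒[]=)
open import Data.Bool using (Bool; true; false; if_then_else_; T)
open import Data.Bool.Properties using (T-≡)
open import Data.List using (allFin)
open import Data.List.Extrema.Nat using (argmin; f[argmin]≤f[xs])
open import Data.List.Membership.Propositional.Properties using (∈-allFin)
import Data.List.Relation.Unary.All as All
open import Data.Product using (Σ; ∃; _×_; _,_; proj₁; proj₂)
import Data.Product as Product
open import Data.Sum using (inj₁; inj₂; [_,_]′)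
open import Data.Empty using (⊥-elim)
open import Function using (_∘_; id)
open import Function.Bundles using (Equivalence)
open import Function.Definitions using (Injective)
open import Relation.Binary.Definitions using (Antitonic₁)
open import Relation.Binary.PropositionalEquality
open import Relation.Nullary using (yes; no; contradiction)
open import Data.Nat.Tactic.RingSolver using (solve-∀)
open import Algebra.Properties.CommutativeSemigroup +-commutativeSemigroup using () renaming (interchange to +-interchange)

ΣFin-cong : ∀ {d} {f g : Fin d → ℕ} → (∀ i → f i ≡ g i) → ΣFin f ≡ ΣFin g
ΣFin-cong {zero}  f≗g = refl
ΣFin-cong {suc d} f≗g = cong₂ _+_ (f≗g zero) (ΣFin-cong (f≗g ∘ suc))

ΣFin-mono : ∀ {d} {f g : Fin d → ℕ} → (∀ i → f i ≤ g i) → ΣFin f ≤ ΣFin g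
ΣFin-mono {zero}  f≤g = z≤n
ΣFin-mono {suc d} f≤g = +-mono-≤ (f≤g zero) (ΣFin-mono (f≤g ∘ suc))

ΣFin-+ : ∀ {d} (f g : Fin d → ℕ) → ΣFin (λ i → f i + g i) ≡ ΣFin f + ΣFin g
ΣFin-+ {zero}  f g = refl
ΣFin-+ {suc d} f g =
  trans (cong (f zero + g zero +_) (ΣFin-+ (f ∘ suc) (g ∘ suc))) (+-interchange (f zero) (g zero) _ _)

ΣFin-splitAt : ∀ a {b} (f : Fin (a + b) → ℕ) →
  ΣFin f ≡ ΣFin (f ∘ (_↑ˡ b)) + ΣFin (f ∘ (a ↑ʳ_))
ΣFin-splitAt zero    f = refl
ΣFin-splitAt (suc a) f = trans (cong (f zero +_) (ΣFin-splitAt a (f ∘ suc))) (sym (+-assoc (f zero) _ _))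

joinΣ : ∀ {N} (r : Fin N → ℕ) → Σ (Fin N) (Fin ∘ r) → Fin (ΣFin r)
joinΣ r (zero  , j) = j ↑ˡ _
joinΣ r (suc i , j) = r zero ↑ʳ joinΣ (r ∘ suc) (i , j)

splitΣ : ∀ {N} (r : Fin N → ℕ) → Fin (ΣFin r) → Σ (Fin N) (Fin ∘ r)
splitΣ {suc N} r t = [ (zero ,_) , Product.map suc id ∘ splitΣ (r ∘ suc) ]′ (splitAt (r zero) t)

splitΣ-joinΣ : ∀ {N} (r : Fin N → ℕ) s → splitΣ r (joinΣ r s) ≡ s
splitΣ-joinΣ r (zero , j) rewrite splitAt-↑ˡ (r zero) j (ΣFin (r ∘ suc)) = refl
splitΣ-joinΣ r (suc i , j) rewrite splitAt-↑ʳ (r zero) (ΣFin (r ∘ suc)) (joinΣ (r ∘ suc) (i , j))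
  = cong (Product.map suc id) (splitΣ-joinΣ (r ∘ suc) (i , j))

joinΣ-splitΣ : ∀ {N} (r : Fin N → ℕ) t → joinΣ r (splitΣ r t) ≡ t
joinΣ-splitΣ {suc N} r t with splitAt (r zero) t in eq
... | inj₁ j = splitAt⁻¹-↑ˡ eq
... | inj₂ t′ = trans (cong (r zero ↑ʳ_) (joinΣ-splitΣ (r ∘ suc) t′)) (splitAt⁻¹-↑ʳ eq)

joinΣ-injective : ∀ {N} (r : Fin N → ℕ) → Injective _≡_ _≡_ (joinΣ r)
joinΣ-injective r {s} {s′} eq = begin
  s                        ≡⟨ splitΣ-joinΣ r s ⟨
  splitΣ r (joinΣ r s)     ≡⟨ cong (splitΣ r) eq ⟩
  splitΣ r (joinΣ r s′)    ≡⟨ splitΣ-joinΣ r s′ ⟩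
  s′                       ∎
  where open ≡-Reasoning

splitΣ-injective : ∀ {N} (r : Fin N → ℕ) → Injective _≡_ _≡_ (splitΣ r)
splitΣ-injective r {t} {t′} eq = begin
  t                        ≡⟨ joinΣ-splitΣ r t ⟨
  joinΣ r (splitΣ r t)     ≡⟨ cong (joinΣ r) eq ⟩
  joinΣ r (splitΣ r t′)    ≡⟨ joinΣ-splitΣ r t′ ⟩
  t′                       ∎
  where open ≡-Reasoning

indicator : Bool → ℕ
indicator b = if b then 1 else 0

count : ∀ {d} → (Fin d → Bool) → ℕ
count b = ΣFin (indicator ∘ b)

selectSum : ∀ {d} → (Fin d → Bool) → (Fin d → ℕ) → ℕ
selectSum S r = ΣFin (λ i → if S i then r i else 0)

count-const : ∀ d b → count {d} (λ _ → b) ≡ (if b then d else 0)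
count-const zero    true  = refl
count-const zero    false = refl
count-const (suc d) true  = cong suc (count-const d true)
count-const (suc d) false = count-const d false

count-mono : ∀ {d} {b c : Fin d → Bool} → (∀ t → T (b t) → T (c t)) → count b ≤ count c
count-mono b⇒c = ΣFin-mono (λ t → indicator-mono (b⇒c t))
  where
  indicator-mono : ∀ {x y} → (T x → T y) → indicator x ≤ indicator y
  indicator-mono {false}          _   = z≤n
  indicator-mono {true}  {true}   _   = ≤-refl
  indicator-mono {true}  {false} x⇒y = ⊥-elim (x⇒y _)

∣p∣≡count : ∀ {d} (p : Subset d) → ∣ p ∣ ≡ count (lookup p)
∣p∣≡count []          = refl
∣p∣≡count (true  ∷ p) = cong suc (∣p∣≡count p)
∣p∣≡count (false ∷ p) = ∣p∣≡count p

∈⇒T : ∀ {d x} {p : Subset d} → x ∈ p → T (lookup p x)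
∈⇒T x∈p = subst T (sym ([]=⇒lookup x∈p)) _

T⇒∈ : ∀ {d x} {p : Subset d} → T (lookup p x) → x ∈ p
T⇒∈ {x = x} {p} = lookup⇒[]= x p ∘ Equivalence.to T-≡

-- Fin (count b) enumerates Σ (Fin d) (Fin ∘ indicator ∘ b), whose fibres have at most one element.
private
  T⇒Fin-indicator : ∀ {x} → T x → Fin (indicator x)
  T⇒Fin-indicator {true} _ = zero

  Fin-indicator⇒T : ∀ {x} → Fin (indicator x) → T x
  Fin-indicator⇒T {true} _ = _

  Fin-indicator-irrelevant : ∀ x (i j : Fin (indicator x)) → i ≡ j
  Fin-indicator-irrelevant true zero zero = refl

injection⇒≤count : ∀ {d m} (b : Fin d → Bool) (h : Fin m → Fin d) →
  Injective _≡_ _≡_ h → (∀ i → T (b (h i))) → m ≤ count b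
injection⇒≤count {m = m} b h h-inj h∈b =
  injective⇒≤ {f = embed} (h-inj ∘ cong proj₁ ∘ joinΣ-injective (indicator ∘ b))
  where
  embed : Fin m → Fin (count b)
  embed i = joinΣ (indicator ∘ b) (h i , T⇒Fin-indicator (h∈b i))

≤count⇒injection : ∀ {d m} (b : Fin d → Bool) → m ≤ count b →
  Σ (Fin m → Fin d) λ h → Injective _≡_ _≡_ h × (∀ i → T (b (h i)))
≤count⇒injection {d} {m} b m≤count = proj₁ ∘ member , member-inj , Fin-indicator⇒T ∘ proj₂ ∘ member
  where
  member : Fin m → Σ (Fin d) (Fin ∘ indicator ∘ b)
  member i = splitΣ (indicator ∘ b) (inject≤ i m≤count)
  same-member : ∀ {s s′ : Σ (Fin d) (Fin ∘ indicator ∘ b)} → proj₁ s ≡ proj₁ s′ → s ≡ s′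
  same-member {t , x} {.t , y} refl = cong (t ,_) (Fin-indicator-irrelevant (b t) x y)
  member-inj : Injective _≡_ _≡_ (proj₁ ∘ member)
  member-inj {i} {j} eq = inject≤-injective _ _ i j (splitΣ-injective _ (same-member eq))

count-≤-injection : ∀ {d e} {b : Fin d → Bool} {c : Fin e → Bool} (φ : ∀ t → T (b t) → Fin e) →
  (∀ {s t} s∈b t∈b → φ s s∈b ≡ φ t t∈b → s ≡ t) → (∀ t t∈b → T (c (φ t t∈b))) →
  count b ≤ count c
count-≤-injection {b = b} {c} φ φ-inj φ∈c with ≤count⇒injection b ≤-refl
... | h , h-inj , h∈b = injection⇒≤count c (λ i → φ (h i) (h∈b i)) (h-inj ∘ φ-inj _ _) (λ i → φ∈c _ _)

count-splitΣ : ∀ {N} (r : Fin N → ℕ) (S : Fin N → Bool) →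
  count (S ∘ proj₁ ∘ splitΣ r) ≡ selectSum S r
count-splitΣ {zero}  r S = refl
count-splitΣ {suc N} r S = begin
  count (S ∘ proj₁ ∘ splitΣ r)
    ≡⟨ ΣFin-splitAt (r zero) _ ⟩
  ΣFin (λ j → indicator (S (proj₁ (splitΣ r (j ↑ˡ ΣFin (r ∘ suc))))))
    + ΣFin (λ t → indicator (S (proj₁ (splitΣ r (r zero ↑ʳ t)))))
    ≡⟨ cong₂ _+_ (ΣFin-cong first-block) (ΣFin-cong later-blocks) ⟩
  count {r zero} (λ _ → S zero) + count (S ∘ suc ∘ proj₁ ∘ splitΣ (r ∘ suc))
    ≡⟨ cong₂ _+_ (count-const (r zero) (S zero)) (count-splitΣ (r ∘ suc) (S ∘ suc)) ⟩
  selectSum S r ∎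
  where
  open ≡-Reasoning
  first-block : ∀ j → indicator (S (proj₁ (splitΣ r (j ↑ˡ ΣFin (r ∘ suc))))) ≡ indicator (S zero)
  first-block j rewrite splitAt-↑ˡ (r zero) j (ΣFin (r ∘ suc)) = refl
  later-blocks : ∀ t → indicator (S (proj₁ (splitΣ r (r zero ↑ʳ t))))
                     ≡ indicator (S (suc (proj₁ (splitΣ (r ∘ suc) t))))
  later-blocks t rewrite splitAt-↑ʳ (r zero) (ΣFin (r ∘ suc)) t = refl

private
  indicator-<ᵇ-suc : ∀ x c → indicator (x <ᵇ suc c) ≡ indicator (x <ᵇ c) + indicator (x ≡ᵇ c)
  indicator-<ᵇ-suc zero    zero    = refl
  indicator-<ᵇ-suc zero    (suc c) = refl
  indicator-<ᵇ-suc (suc x) zero    = refl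
  indicator-<ᵇ-suc (suc x) (suc c) = indicator-<ᵇ-suc x c

pigeonhole-fibres : ∀ {d k a w} (f : Fin d → ℕ) → (∀ c → count (λ t → f t ≡ᵇ c) ≤ k) →
  (∀ t → a ≤ f t) → (∀ t → f t < w + a) → d ≤ w * k
pigeonhole-fibres {d} {k} {a} {w} f fibre≤k a≤f f<w+a = begin
  d                               ≡⟨ count-const d true ⟨
  count {d} (λ _ → true)          ≤⟨ count-mono (λ t _ → <⇒<ᵇ (f<w+a t)) ⟩
  count (λ t → f t <ᵇ w + a)      ≤⟨ below w ⟩
  w * k                           ∎
  where
  open ≤-Reasoning
  below : ∀ c → count (λ t → f t <ᵇ c + a) ≤ c * k
  below zero = begin
    count (λ t → f t <ᵇ a)        ≤⟨ count-mono (λ t f<a → contradiction (<ᵇ⇒< _ _ f<a) (≤⇒≯ (a≤f t))) ⟩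
    count {d} (λ _ → false)       ≡⟨ count-const d false ⟩
    0                             ∎
  below (suc c) = begin
    count (λ t → f t <ᵇ suc c + a)
      ≡⟨ ΣFin-cong (λ t → indicator-<ᵇ-suc (f t) (c + a)) ⟩
    ΣFin (λ t → indicator (f t <ᵇ c + a) + indicator (f t ≡ᵇ c + a))
      ≡⟨ ΣFin-+ (λ t → indicator (f t <ᵇ c + a)) (λ t → indicator (f t ≡ᵇ c + a)) ⟩
    count (λ t → f t <ᵇ c + a) + count (λ t → f t ≡ᵇ c + a)
      ≤⟨ +-mono-≤ (below c) (fibre≤k (c + a)) ⟩
    c * k + k
      ≡⟨ +-comm (c * k) k ⟩
    suc c * k ∎

-- headSum n is prefixSum (suc n) on the nose.
prefixSum : ∀ {d} → ℕ → (Fin d → ℕ) → ℕ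
prefixSum m = selectSum (λ i → toℕ i <ᵇ m)

prefixSum-tail≤ : ∀ {d} {r : Fin (suc d) → ℕ} → Antitonic₁ _≤ᶠ_ _≤_ r →
  ∀ m → prefixSum m (r ∘ suc) ≤ prefixSum m r
prefixSum-tail≤              r↓ zero    = ≤-refl
prefixSum-tail≤ {zero}       r↓ (suc m) = z≤n
prefixSum-tail≤ {suc d}      r↓ (suc m) =
  +-mono-≤ (r↓ {suc zero} {zero} z≤n) (prefixSum-tail≤ (λ i≤j → r↓ (s≤s i≤j)) m)

selectSum≤prefixSum : ∀ {d} {r : Fin d → ℕ} → Antitonic₁ _≤ᶠ_ _≤_ r →
  ∀ (S : Fin d → Bool) {m} → count S ≤ m → selectSum S r ≤ prefixSum m r
selectSum≤prefixSum {zero}  r↓ S _ = z≤n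
selectSum≤prefixSum {suc d} {r} r↓ S {m} cS≤m with S zero
... | true with m | cS≤m
...   | suc m′ | s≤s cS′≤m′ = +-monoʳ-≤ (r zero) (selectSum≤prefixSum (λ i≤j → r↓ (s≤s i≤j)) (S ∘ suc) cS′≤m′)
selectSum≤prefixSum {suc d} r↓ S {m} cS≤m | false =
  ≤-trans (selectSum≤prefixSum (λ i≤j → r↓ (s≤s i≤j)) (S ∘ suc) cS≤m) (prefixSum-tail≤ r↓ m)

headSum+tailSum : ∀ n (r : Fin (Npts n) → ℕ) → headSum n r + tailSum n r ≡ ΣFin r
headSum+tailSum n r = trans (sym (ΣFin-+ head tail)) (ΣFin-cong (λ i → recombine (toℕ i <ᵇ suc n) (r i)))
  where
  head tail : Fin (Npts n) → ℕ
  head i = if toℕ i <ᵇ suc n then r i else 0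
  tail i = if toℕ i <ᵇ suc n then 0 else r i
  recombine : ∀ b x → (if b then x else 0) + (if b then 0 else x) ≡ x
  recombine true  x = +-identityʳ x
  recombine false x = refl

-- count listed is an upper bound for the degree of x.
record NeighbourListing (G : Graph) (x : V G) (d : ℕ) : Set where
  field
    vertex  : Fin d → V G
    listed  : Fin d → Bool
    listing : ∀ {w} → Adj G x w → Σ (Fin d) λ t → vertex t ≡ w × T (listed t)

  index : ∀ {w} → Adj G x w → Fin d
  index = proj₁ ∘ listing

  index-listed : ∀ {w} (xw : Adj G x w) → T (listed (index xw))
  index-listed = proj₂ ∘ proj₂ ∘ listing

  index-injective : ∀ {w w′} (xw : Adj G x w) (xw′ : Adj G x w′) → index xw ≡ index xw′ → w ≡ w′
  index-injective xw xw′ eq =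
    trans (sym (proj₁ (proj₂ (listing xw)))) (trans (cong vertex eq) (proj₁ (proj₂ (listing xw′))))

open NeighbourListing

colour-span : ∀ {G : Graph} {α : EdgeColoring G} → IsInterval G α →
  ∀ {x d y z} (L : NeighbourListing G x d) → Adj G x y → Adj G x z →
  col α x z < col α x y + count (listed L)
colour-span {G} {α} interval {x} {d} {y} {z} L xy xz with ≤-total (col α x y) (col α x z)
... | inj₂ z≤y = ≤-<-trans z≤y (m<m+n (col α x y) y-listed)
  where
  y-listed : 1 ≤ count (listed L)
  y-listed = injection⇒≤count (listed L) (λ _ → index L xy) (λ {i} {j} _ → Fin1-unique i j) (λ _ → index-listed L xy)
    where
    Fin1-unique : (i j : Fin 1) → i ≡ j
    Fin1-unique zero zero = refl
... | inj₁ y≤z = begin-strict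
  col α x z                              ≡⟨ m+[n∸m]≡n y≤z ⟨
  col α x y + (col α x z ∸ col α x y)    <⟨ +-monoʳ-< (col α x y) colours≤count ⟩
  col α x y + count (listed L)           ∎
  where
  open ≤-Reasoning
  colour : Fin (suc (col α x z ∸ col α x y)) → ℕ
  colour i = col α x y + toℕ i
  witness : ∀ i → Σ (V G) λ w → Adj G x w × col α x w ≡ colour i
  witness i = interval x y z (colour i) xy xz (m≤m+n _ _)
    (subst (colour i ≤_) (m+[n∸m]≡n y≤z) (+-monoʳ-≤ (col α x y) (toℕ≤pred[n] i)))
  witness-index : Fin (suc (col α x z ∸ col α x y)) → Fin d
  witness-index i = index L (proj₁ (proj₂ (witness i)))
  witness-index-injective : Injective _≡_ _≡_ witness-index
  witness-index-injective {i} {j} eq = toℕ-injective (+-cancelˡ-≡ (col α x y) _ _ (begin-equality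
    colour i                          ≡⟨ proj₂ (proj₂ (witness i)) ⟨
    col α x (proj₁ (witness i))       ≡⟨ cong (col α x) (index-injective L _ _ eq) ⟩
    col α x (proj₁ (witness j))       ≡⟨ proj₂ (proj₂ (witness j)) ⟩
    colour j                          ∎))
  colours≤count : suc (col α x z ∸ col α x y) ≤ count (listed L)
  colours≤count = injection⇒≤count (listed L) witness-index witness-index-injective
    (λ i → index-listed L (proj₁ (proj₂ (witness i))))

module _ {n : ℕ} (π : ProjectivePlane n) where

  line-nonempty : ∀ i → Nonempty (A π i)
  line-nonempty i with nonempty? (A π i)
  ... | yes p∈i  = p∈i
  ... | no  empty = contradiction size≡0 λ ()
    where
    size≡0 : suc n ≡ 0
    size≡0 = trans (sym (line-size π i)) (trans (cong ∣_∣ (Empty-unique empty)) (∣⊥∣≡0 (Npts n)))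

  common-point : ∀ i j → ∃ λ p → p ∈ A π i × p ∈ A π j
  common-point i j with i ≟ᶠ j
  ... | yes refl = Product.map₂ (λ p∈i → p∈i , p∈i) (line-nonempty i)
  ... | no  i≢j  = Product.map₂ proj₁ (two-lines π i j i≢j)

  unique-line : ∀ {p q i j} → p ≢ q → p ∈ A π i → q ∈ A π i → p ∈ A π j → q ∈ A π j → i ≡ j
  unique-line {p} {q} p≢q p∈i q∈i p∈j q∈j with two-points π p q p≢q
  ... | _ , _ , through-p-q = trans (through-p-q _ p∈i q∈i) (sym (through-p-q _ p∈j q∈j))

  module _ (1≤n : 1 ≤ n) where

    line<plane : suc n < Npts n
    line<plane = begin
      suc (suc n)    ≡⟨ cong suc (+-comm 1 n) ⟩
      1 + n + 1      ≤⟨ +-monoˡ-≤ 1 (+-monoˡ-≤ n (*-mono-≤ 1≤n 1≤n)) ⟩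
      n * n + n + 1  ∎
      where open ≤-Reasoning

    another-point : ∀ p → ∃ λ q → p ≢ q
    another-point p = ¬∀⟶∃¬ _ (p ≡_) (p ≟ᶠ_) λ all≡p →
      <⇒≱ (≤-<-trans (s≤s z≤n) line<plane)
          (injective⇒≤ {f = λ (_ : Fin (Npts n)) → zero {0}} (λ {q} {q′} _ → trans (sym (all≡p q)) (all≡p q′)))

    point-off-line : ∀ i → ∃ λ q → q ∉ A π i
    point-off-line i = ¬∀⟶∃¬ _ (_∈ A π i) (_∈? A π i) λ all∈i →
      <⇒≢ line<plane (begin-equality
        suc n         ≡⟨ line-size π i ⟨
        ∣ A π i ∣     ≡⟨ cong ∣_∣ (⊆-antisym ⊆⊤ (λ {q} _ → all∈i q)) ⟩
        ∣ ⊤ {Npts n} ∣ ≡⟨ ∣⊤∣≡n (Npts n) ⟩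
        Npts n        ∎)
      where open ≤-Reasoning

    -- The line joining another point p′ of a line ℓ through p to a point off ℓ misses p.
    line-avoiding : ∀ p → ∃ λ m → p ∉ A π m
    line-avoiding p with another-point p
    ... | p′ , p≢p′ with two-points π p p′ p≢p′
    ...   | ℓ , (p∈ℓ , p′∈ℓ) , _ with point-off-line ℓ
    ...     | q , q∉ℓ with two-points π p′ q (λ { refl → q∉ℓ p′∈ℓ })
    ...       | m , (p′∈m , q∈m) , _ =
      m , λ p∈m → q∉ℓ (subst (λ j → q ∈ A π j) (unique-line p≢p′ p∈m p′∈m p∈ℓ p′∈ℓ) q∈m)

    -- Each line through p meets a fixed line L ∌ p, and in distinct points.
    lines-through≤ : ∀ p → count (λ i → lookup (A π i) p) ≤ suc n
    lines-through≤ p with line-avoiding p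
    ... | L , p∉L = begin
      count (λ i → lookup (A π i) p)   ≤⟨ count-≤-injection meet meet-injective (λ i p∈i → ∈⇒T (meet∈L i p∈i)) ⟩
      count (lookup (A π L))           ≡⟨ ∣p∣≡count (A π L) ⟨
      ∣ A π L ∣                        ≡⟨ line-size π L ⟩
      suc n                            ∎
      where
      open ≤-Reasoning
      through-p≢L : ∀ i → T (lookup (A π i) p) → i ≢ L
      through-p≢L i p∈i refl = p∉L (T⇒∈ p∈i)
      meet : ∀ i → T (lookup (A π i) p) → Fin (Npts n)
      meet i p∈i = proj₁ (two-lines π i L (through-p≢L i p∈i))
      meet∈i : ∀ i p∈i → meet i p∈i ∈ A π i
      meet∈i i p∈i = proj₁ (proj₁ (proj₂ (two-lines π i L (through-p≢L i p∈i))))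
      meet∈L : ∀ i p∈i → meet i p∈i ∈ A π L
      meet∈L i p∈i = proj₂ (proj₁ (proj₂ (two-lines π i L (through-p≢L i p∈i))))
      meet-injective : ∀ {i j} p∈i p∈j → meet i p∈i ≡ meet j p∈j → i ≡ j
      meet-injective {i} {j} p∈i p∈j eq =
        unique-line p≢meet (T⇒∈ p∈i) (meet∈i i p∈i) (T⇒∈ p∈j) (subst (_∈ A π j) (sym eq) (meet∈i j p∈j))
        where
        p≢meet : p ≢ meet i p∈i
        p≢meet p≡meet = p∉L (subst (_∈ A π L) (sym p≡meet) (meet∈L i p∈i))

chain-bound : ∀ {a b c d x y} → b < x + suc c → x < y + d → y < a + suc c → b < c + c + d + a
chain-bound {a} {b} {c} {d} {x} {y} b<x+1+c x<y+d y<a+1+c = begin-strict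
  b              <⟨ b<x+1+c ⟩
  x + suc c      ≡⟨ +-suc x c ⟩
  suc x + c      ≤⟨ +-monoˡ-≤ c x<y+d ⟩
  y + d + c      ≤⟨ +-monoˡ-≤ c (+-monoˡ-≤ d (≤-pred (subst (suc y ≤_) (+-suc a c) y<a+1+c))) ⟩
  a + c + d + c  ≡⟨ rearrange a c d ⟩
  c + c + d + a  ∎
  where
  open ≤-Reasoning
  rearrange : ∀ a c d → a + c + d + c ≡ c + c + d + a
  rearrange = solve-∀

module _ {n : ℕ} (π : ProjectivePlane n) (r : Fin (Npts n) → ℕ) where

  vertexOf : Fin (ΣFin r) → ErdV π r
  vertexOf t = vtx (proj₁ (splitΣ r t)) (proj₂ (splitΣ r t))

  vertexOf-injective : Injective _≡_ _≡_ vertexOf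
  vertexOf-injective eq = splitΣ-injective r (vtx-injective eq)
    where
    vtx-injective : ∀ {i i′ j j′} → vtx {π = π} {r} i j ≡ vtx i′ j′ → (i , j) ≡ (i′ , j′)
    vtx-injective refl = refl

  vtx-listing : ∀ i j → NeighbourListing (Erd π r) (vtx i j) (suc (Npts n))
  vertex  (vtx-listing i j) zero    = u
  vertex  (vtx-listing i j) (suc q) = pt q
  listed  (vtx-listing i j) zero    = true
  listed  (vtx-listing i j) (suc q) = lookup (A π i) q
  listing (vtx-listing i j) (v-u .i .j)       = zero , refl , _
  listing (vtx-listing i j) (v-p .i .j q q∈i) = suc q , refl , ∈⇒T q∈i

  vtx-degree : ∀ i j → count (listed (vtx-listing i j)) ≡ suc (suc n)
  vtx-degree i j = cong suc (trans (sym (∣p∣≡count (A π i))) (line-size π i))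

  pt-listing : ∀ p → NeighbourListing (Erd π r) (pt p) (ΣFin r)
  vertex  (pt-listing p) = vertexOf
  listed  (pt-listing p) t = lookup (A π (proj₁ (splitΣ r t))) p
  listing (pt-listing p) (p-v i j .p p∈i) = joinΣ r (i , j) ,
    subst (λ s → vtx (proj₁ s) (proj₂ s) ≡ vtx i j × T (lookup (A π (proj₁ s)) p))
          (sym (splitΣ-joinΣ r (i , j))) (refl , ∈⇒T p∈i)

  pt-degree≤ : 1 ≤ n → Antitonic₁ _≤ᶠ_ _≤_ r → ∀ p → count (listed (pt-listing p)) ≤ headSum n r
  pt-degree≤ 1≤n r↓ p = begin
    count (listed (pt-listing p))            ≡⟨ count-splitΣ r (λ i → lookup (A π i) p) ⟩
    selectSum (λ i → lookup (A π i) p) r     ≤⟨ selectSum≤prefixSum r↓ _ (lines-through≤ π 1≤n p) ⟩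
    headSum n r                              ∎
    where open ≤-Reasoning

  module _ (α : EdgeColoring (Erd π r)) where

    colourAtU : Fin (ΣFin r) → ℕ
    colourAtU t = col α u (vertexOf t)

    colour-class≤ : ∀ {k} → IsImproper (Erd π r) k α → ∀ c → count (λ t → colourAtU t ≡ᵇ c) ≤ k
    colour-class≤ {k} improper c with suc k ≤? count (λ t → colourAtU t ≡ᵇ c)
    ... | no  k≱count = ≤-pred (≰⇒> k≱count)
    ... | yes k<count with ≤count⇒injection _ k<count
    ...   | h , h-inj , same-colour = ⊥-elim (improper u c (vertexOf ∘ h) (h-inj ∘ vertexOf-injective)
                                               (λ _ → u-v _ _) (λ i → ≡ᵇ⇒≡ _ _ (same-colour i)))

    -- Take a common point p of the lines of v = vertexOf s and v′ = vertexOf t. At each of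
    -- v′, p, v the two edges of the closed walk u v′ p v u differ in colour by less than the degree.
    colour-spread : IsInterval (Erd π r) α → 1 ≤ n → Antitonic₁ _≤ᶠ_ _≤_ r →
      ∀ s t → colourAtU t < suc n + suc n + headSum n r + colourAtU s
    colour-spread interval 1≤n r↓ s t
      with splitΣ r s | splitΣ r t | common-point π (proj₁ (splitΣ r s)) (proj₁ (splitΣ r t))
    ... | i , j | i′ , j′ | p , p∈i , p∈i′ = chain-bound at-v′ at-p at-v
      where
      at-v′ : col α u (vtx i′ j′) < col α (vtx i′ j′) (pt p) + suc (suc n)
      at-v′ = subst₂ (λ c m → c < col α (vtx i′ j′) (pt p) + m) (col-sym α _ _ (v-u i′ j′)) (vtx-degree i′ j′)
                (colour-span {α = α} interval (vtx-listing i′ j′) (v-p i′ j′ p p∈i′) (v-u i′ j′))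
      at-p : col α (vtx i′ j′) (pt p) < col α (vtx i j) (pt p) + headSum n r
      at-p = subst₂ (λ c c′ → c < c′ + headSum n r) (col-sym α _ _ (p-v i′ j′ p p∈i′)) (col-sym α _ _ (p-v i j p p∈i))
                (<-≤-trans (colour-span {α = α} interval (pt-listing p) (p-v i j p p∈i) (p-v i′ j′ p p∈i′))
                           (+-monoʳ-≤ _ (pt-degree≤ 1≤n r↓ p)))
      at-v : col α (vtx i j) (pt p) < col α u (vtx i j) + suc (suc n)
      at-v = subst₂ (λ c m → col α (vtx i j) (pt p) < c + m) (col-sym α _ _ (v-u i j)) (vtx-degree i j)
                (colour-span {α = α} interval (vtx-listing i j) (v-u i j) (v-p i j p p∈i))

    degree-u≤ : ∀ {k} → IsImproper (Erd π r) k α → IsInterval (Erd π r) α →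
      1 ≤ n → Antitonic₁ _≤ᶠ_ _≤_ r → Fin (ΣFin r) → ΣFin r ≤ (suc n + suc n + headSum n r) * k
    degree-u≤ improper interval 1≤n r↓ t₀ =
      pigeonhole-fibres colourAtU (colour-class≤ improper) least≤ (colour-spread interval 1≤n r↓ least)
      where
      least : Fin (ΣFin r)
      least = argmin colourAtU t₀ (allFin _)
      least≤ : ∀ t → colourAtU least ≤ colourAtU t
      least≤ t = All.lookup (f[argmin]≤f[xs] t₀ (allFin _)) (∈-allFin t)

theorem16 : (n : ℕ) → 2 ≤ n → (π : ProjectivePlane n) →
    (k : ℕ) → 1 ≤ k →
    (r : Fin (Npts n) → ℕ) →
    (∀ i j → i ≤ᶠ j → r j ≤ r i) →
    (∀ i → 1 ≤ r i) →
    (k ∸ 1) * headSum n r + 2 * k * (n + 1) < tailSum n r →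
    μint-exceeds (Erd π r) k
theorem16 n (s≤s (s≤s _)) π (suc k₀) _ r r↓ r>0 hyp k k≤1+k₀ (α , improper , interval) =
  <-irrefl refl (begin-strict
  ΣFin r                                  ≤⟨ degree-u≤ π r α improper interval (s≤s z≤n) (λ {i} {j} → r↓ j i) t₀ ⟩
  (suc n + suc n + hd) * k                ≤⟨ *-monoʳ-≤ (suc n + suc n + hd) k≤1+k₀ ⟩
  (suc n + suc n + hd) * suc k₀           ≡⟨ expand n hd k₀ ⟩
  hd + (k₀ * hd + 2 * suc k₀ * (n + 1))   <⟨ +-monoʳ-< hd hyp ⟩
  hd + tailSum n r                        ≡⟨ headSum+tailSum n r ⟩
  ΣFin r                                  ∎)
  where
  open ≤-Reasoning
  hd : ℕ
  hd = headSum n r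
  t₀ : Fin (ΣFin r)
  t₀ = joinΣ r (zero , fromℕ< (r>0 zero))
  expand : ∀ n h k → (suc n + suc n + h) * suc k ≡ h + (k * h + 2 * suc k * (n + 1))
  expand = solve-∀
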